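{- Let $w=\langle A,D,n\rangle$ be an interaction system on $I$, $i:I$ and $\alpha:A^\sharp(i)$. There are functions \[ \prod_{\beta:D^\sharp(i,\alpha)}(n^\sharp\,i\,\alpha\,\beta)\in\nu_w \quad\longleftrightarrow\quad \alpha\in\nu_{\mathrm{Layered}(w,i)} \] that are, up to bisimulation, inverse to each other. In particular, there are functions $f:i\in\nu_w\to\mathtt{Leaf}\in\nu_{\mathrm{Layered}(w,i)}$ and $g:\mathtt{Leaf}\in\nu_{\mathrm{Layered}(w,i)}\to i\in\nu_w$ such that $fg\approx\mathrm{id}$ and $gf\approx\mathrm{id}$.
   Context: An indexed container (interaction system) $w=\langle A,D,n\rangle$ over $I$ has moves $A(i)$, responses $D(i,a)$ and next state $n(i,a,d)$. For a predicate $X$ on $I$, $i\in X$ means $X(i)$; $\nu_w$ denotes the weakly terminal coalgebra of the extension $[\![w]\!](X)(i)=\sum_{a:A(i)}\prod_{d:D(i,a)} n(i,a,d)\in X$. The container $w^\sharp=\langle A^\sharp,D^\sharp,n^\sharp\rangle$ is defined by induction-recursion: $A^\sharp(i)$ has constructors $\mathtt{Leaf}:A^\sharp(i)$ and $\alpha\triangleleft l:A^\sharp(i)$ for $\alpha:A^\sharp(i)$, $l:\prod_{\beta:D^\sharp(i,\alpha)}A(n^\sharp\,i\,\alpha\,\beta)$; $D^\sharp(i,\mathtt{Leaf})=\mathbf{1}$, $D^\sharp(i,\alpha\triangleleft l)=\sum_{\beta:D^\sharp(i,\alpha)}D(n^\sharp\,i\,\alpha\,\beta,l\,\beta)$; $n^\sharp\,i\,\mathtt{Leaf}\,\star=i$,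 $n^\sharp\,i\,(\alpha\triangleleft l)\,\langle\beta,d\rangle=n(n^\sharp\,i\,\alpha\,\beta,\,l\,\beta,\,d)$. So $\alpha$ is a complete finite-depth tree and $D^\sharp(i,\alpha)$ its set of terminal leaves. $\mathrm{Layered}(w,i)$ is the interaction system with states $A^\sharp(i)$, actions at $\alpha$ given by layers $l:\prod_{\beta:D^\sharp(i,\alpha)}A(n^\sharp\,i\,\alpha\,\beta)$, a single trivial response $\star$, and next state $\alpha\triangleleft l$. $\approx$ denotes bisimilarity. It follows from the preceding lemma that the predicate $\alpha\mapsto\prod_{\beta:D^\sharp(i,\alpha)}(n^\sharp\,i\,\alpha\,\beta)\in\nu_w$ is a weakly terminal coalgebra for $[\![\mathrm{Layered}(w,i)]\!]$, together with the fact that two weakly terminal coalgebras for the same functor are related by mediating morphisms inverse up to bisimilarity. -}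

module Defs where

open import Level using (Level; suc; zero)
open import Data.Unit using (⊤; tt)
open import Data.Product using (Σ; _,_; proj₁; proj₂)
open import Relation.Binary.PropositionalEquality using (_≡_; refl)

record IS (I : Set) : Set₁ where
  field
    A : I → Set
    D : (i : I) → A i → Set
    n : (i : I) (a : A i) → D i a → I
open IS public

⟦_⟧ : {I : Set} → IS I → (I → Set) → I → Set
⟦ w ⟧ X i = Σ (A w i) λ a → (d : D w i a) → X (n w i a d)

-- ν_w : the weakly terminal coalgebra of ⟦ w ⟧ (without coinduction):
-- an element is a state of some ⟦ w ⟧-coalgebra.
record ν {I : Set} (w : IS I) (i : I) : Set₁ where
  field
    Carrier : I → Set
    coalg   : ∀ {j} → Carrier j → ⟦ w ⟧ Carrier j
    elt     : Carrier i
open ν public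

head : {I : Set} {w : IS I} {i : I} → ν w i → A w i
head x = proj₁ (coalg x (elt x))

tail : {I : Set} {w : IS I} {i : I} (x : ν w i) (d : D w i (head x)) → ν w (n w i (head x) d)
tail x d = record { Carrier = Carrier x ; coalg = coalg x ; elt = proj₂ (coalg x (elt x)) d }

module _ {I : Set} (w : IS I) where

  Rel : Set₂
  Rel = ∀ {j} → ν w j → ν w j → Set₁

  TailRel : Rel → {j : I} {a b : A w j} → a ≡ b
          → ((d : D w j a) → ν w (n w j a d))
          → ((d : D w j b) → ν w (n w j b d)) → Set₁
  TailRel R refl f g = ∀ d → R (f d) (g d)

  IsBisimulation : Rel → Set₁
  IsBisimulation R = ∀ {j} {x y : ν w j} → R x y
                   → Σ (head x ≡ head y) λ e → TailRel R e (tail x) (tail y)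

  Bisim : {i : I} → ν w i → ν w i → Set₂
  Bisim x y = Σ Rel λ R → Σ (IsBisimulation R) λ _ → R x y


module Sharp {I : Set} (w : IS I) (i : I) where
  mutual
    data A♯ : Set where
      Leaf : A♯
      _◁_  : (α : A♯) → ((β : D♯ α) → A w (n♯ α β)) → A♯

    D♯ : A♯ → Set
    D♯ Leaf = ⊤
    D♯ (α ◁ l) = Σ (D♯ α) λ β → D w (n♯ α β) (l β)

    n♯ : (α : A♯) → D♯ α → I
    n♯ Leaf tt = i
    n♯ (α ◁ l) (β , d) = n w (n♯ α β) (l β) d

  Layered : IS A♯
  Layered = record
    { A = λ α → (β : D♯ α) → A w (n♯ α β)
    ; D = λ α l → ⊤
    ; n = λ α l _ → α ◁ l
    }
open Sharp public

{-# OPTIONS --safe #-}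
module Submission where

-- A w-coalgebra X induces a Layered(w, i)-coalgebra on γ ↦ Π (β : D♯ γ) X (n♯ γ β), whose next
-- layer collects the heads at all leaves; conversely a Layered-coalgebra Y induces a w-coalgebra on
-- the states found at the leaves of elements of Y. Going around either way, the new state and the
-- old one are sent to the same point by strict coalgebra homomorphisms into a common coalgebra,
-- and that already makes them bisimilar.

open import Defs
open import Level using (Level)
open import Data.Product using (Σ; _×_; _,_; proj₁; proj₂)
open import Data.Product.Properties using (Σ-≡,≡←≡)
open import Data.Unit using (tt)
open import Relation.Binary.PropositionalEquality
  using (_≡_; refl; sym; subst; cong; cong-app; module ≡-Reasoning)

module _ {I : Set} (w : IS I) where

  Coalgebra : (I → Set) → Set
  Coalgebra X = ∀ {j} → X j → ⟦ w ⟧ X j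

  map : {X Y : I → Set} → (∀ {j} → X j → Y j) → ∀ {j} → ⟦ w ⟧ X j → ⟦ w ⟧ Y j
  map h (a , F) = a , λ d → h (F d)

  IsHomomorphism : {X Y : I → Set} → Coalgebra X → Coalgebra Y → (∀ {j} → X j → Y j) → Set
  IsHomomorphism {X} {Y} cX cY h = ∀ {j} (s : X j) → cY (h s) ≡ map {X} {Y} h (cX s)

  record SharedImage {j : I} (u v : ν w j) : Set₁ where
    field
      Target    : I → Set
      target    : Coalgebra Target
      left      : ∀ {k} → Carrier u k → Target k
      right     : ∀ {k} → Carrier v k → Target k
      left-hom  : IsHomomorphism (coalg u) target left
      right-hom : IsHomomorphism (coalg v) target right
      images≡   : left (elt u) ≡ right (elt v)

  atState : {j k : I} (u : ν w j) → Carrier u k → ν w k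
  atState u s = record { Carrier = Carrier u ; coalg = coalg u ; elt = s }

  SharedImage-isBisimulation : IsBisimulation w SharedImage
  SharedImage-isBisimulation {x = u} {y = v} shared =
    split (coalg u (elt u)) (coalg v (elt v)) steps≡
    where
      open SharedImage shared
      open ≡-Reasoning

      mapLeft : ∀ {k} → ⟦ w ⟧ (Carrier u) k → ⟦ w ⟧ Target k
      mapLeft = map {Carrier u} {Target} left

      mapRight : ∀ {k} → ⟦ w ⟧ (Carrier v) k → ⟦ w ⟧ Target k
      mapRight = map {Carrier v} {Target} right

      steps≡ : mapLeft (coalg u (elt u)) ≡ mapRight (coalg v (elt v))
      steps≡ = begin
        mapLeft (coalg u (elt u))   ≡⟨ sym (left-hom (elt u)) ⟩
        target (left (elt u))       ≡⟨ cong target images≡ ⟩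
        target (right (elt v))      ≡⟨ right-hom (elt v) ⟩
        mapRight (coalg v (elt v))  ∎

      Images : (k : I) → A w k → Set
      Images k a = (d : D w k a) → Target (n w k a d)

      tailsRelated : ∀ {k} {a b : A w k} (e : a ≡ b)
                     (F : (d : D w k a) → Carrier u (n w k a d)) (G : (d : D w k b) → Carrier v (n w k b d))
                   → subst (Images k) e (λ d → left (F d)) ≡ (λ d → right (G d))
                   → TailRel w SharedImage e (λ d → atState u (F d)) (λ d → atState v (G d))
      tailsRelated refl F G tails≡ d = record
        { Target = Target ; target = target ; left = left ; right = right
        ; left-hom = left-hom ; right-hom = right-hom ; images≡ = cong-app tails≡ d }

      split : ∀ {k} (p : ⟦ w ⟧ (Carrier u) k) (q : ⟦ w ⟧ (Carrier v) k) → mapLeft p ≡ mapRight q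
            → Σ (proj₁ p ≡ proj₁ q) λ e →
                TailRel w SharedImage e (λ d → atState u (proj₂ p d)) (λ d → atState v (proj₂ q d))
      split {k} (a , F) (b , G) eq =
        let heads≡ , tails≡ = Σ-≡,≡←≡ {B = Images k} eq in heads≡ , tailsRelated heads≡ F G tails≡

  SharedImage⇒Bisim : ∀ {j} {u v : ν w j} → SharedImage u v → Bisim w u v
  SharedImage⇒Bisim shared = SharedImage , SharedImage-isBisimulation , shared

  Coproduct : {B : Set} {m : B → I} → ((β : B) → ν w (m β)) → I → Set
  Coproduct {B} x k = Σ B λ β → Carrier (x β) k

  coproductCoalgebra : {B : Set} {m : B → I} (x : (β : B) → ν w (m β)) → Coalgebra (Coproduct x)
  coproductCoalgebra x (β , s) = proj₁ (coalg (x β) s) , λ d → β , proj₂ (coalg (x β) s) d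

module _ {I : Set} (w : IS I) (i : I) where

  AllLeaves : {ℓ : Level} → (I → Set ℓ) → A♯ w i → Set ℓ
  AllLeaves X γ = (β : D♯ w i γ) → X (n♯ w i γ β)

  layeredCoalgebra : {X : I → Set} → Coalgebra w X → Coalgebra (Layered w i) (AllLeaves X)
  layeredCoalgebra c xs = (λ β → proj₁ (c (xs β))) , λ _ (β , d) → proj₂ (c (xs β)) d

  data LeafOf (Y : A♯ w i → Set) : I → Set where
    leaf : (γ : A♯ w i) → Y γ → (β : D♯ w i γ) → LeafOf Y (n♯ w i γ β)

  leafCoalgebra : {Y : A♯ w i → Set} → Coalgebra (Layered w i) Y → Coalgebra w (LeafOf Y)
  leafCoalgebra c (leaf γ y β) = proj₁ (c y) β , λ d → leaf (γ ◁ proj₁ (c y)) (proj₂ (c y) tt) (β , d)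

  toLayered : {α : A♯ w i} → AllLeaves (ν w) α → ν (Layered w i) α
  toLayered x = record
    { Carrier = AllLeaves (Coproduct w x)
    ; coalg   = layeredCoalgebra (coproductCoalgebra w x)
    ; elt     = λ β → β , elt (x β)
    }

  fromLayered : {α : A♯ w i} → ν (Layered w i) α → AllLeaves (ν w) α
  fromLayered {α} y β = record
    { Carrier = LeafOf (Carrier y)
    ; coalg   = leafCoalgebra (coalg y)
    ; elt     = leaf α (elt y) β
    }

  fromLayered∘toLayered≈id : {α : A♯ w i} (x : AllLeaves (ν w) α) (β : D♯ w i α)
                           → Bisim w (fromLayered (toLayered x) β) (x β)
  fromLayered∘toLayered≈id x β = SharedImage⇒Bisim w record
    { Target    = Coproduct w x
    ; target    = coproductCoalgebra w x
    ; left      = λ { (leaf γ xs β′) → xs β′ }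
    ; right     = β ,_
    ; left-hom  = λ { (leaf γ xs β′) → refl }
    ; right-hom = λ _ → refl
    ; images≡   = refl
    }

  toLayered∘fromLayered≈id : {α : A♯ w i} (y : ν (Layered w i) α)
                           → Bisim (Layered w i) (toLayered (fromLayered y)) y
  toLayered∘fromLayered≈id y = SharedImage⇒Bisim (Layered w i) record
    { Target    = AllLeaves (LeafOf (Carrier y))
    ; target    = layeredCoalgebra (leafCoalgebra (coalg y))
    ; left      = λ xs β → proj₂ (xs β)
    ; right     = λ {γ} s β → leaf γ s β
    ; left-hom  = λ _ → refl
    ; right-hom = λ _ → refl
    ; images≡   = refl
    }

corollary5p4 : {I : Set} (w : IS I) (i : I) (α : A♯ w i)
    → Σ (((β : D♯ w i α) → ν w (n♯ w i α β)) → ν (Layered w i) α) (λ f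
      → Σ (ν (Layered w i) α → ((β : D♯ w i α) → ν w (n♯ w i α β))) (λ g
      → ((x : (β : D♯ w i α) → ν w (n♯ w i α β)) (β : D♯ w i α) → Bisim w (g (f x) β) (x β))
      × ((y : ν (Layered w i) α) → Bisim (Layered w i) (f (g y)) y)))
    × Σ (ν w i → ν (Layered w i) (Leaf {w = w} {i = i})) (λ f
      → Σ (ν (Layered w i) (Leaf {w = w} {i = i}) → ν w i) (λ g
      → ((x : ν w i) → Bisim w (g (f x)) x)
      × ((y : ν (Layered w i) (Leaf {w = w} {i = i})) → Bisim (Layered w i) (f (g y)) y)))
corollary5p4 w i α =
  (toLayered w i , fromLayered w i , fromLayered∘toLayered≈id w i , toLayered∘fromLayered≈id w i)
  , (λ x → toLayered w i (λ _ → x)) , (λ y → fromLayered w i y tt)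
  , (λ x → fromLayered∘toLayered≈id w i (λ _ → x) tt) , toLayered∘fromLayered≈id w i
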